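{- Let $G=(V,E)$ be a graph, let $k\ge 2$, and let $\{S_1,\dots,S_k\}$ be a partition of $V$ into $k$ parts. For $i\in[k]$ let $\mathbf{s}^{(i)}\in\mathbb{R}^n$ be defined by $s^{(i)}_j=-k+1$ if $v_j\in S_i$ and $s^{(i)}_j=1$ otherwise. Then $(q,\mathbf{s}^{(i)})$ is an eigenpair of the signless Laplacian $Q=D+A$ of $G$ for every $i\in[k]$ if and only if $$d_{v_l}(G)+d_{v_l}(S_i)-d_{v_l}(S_i,S_j)=q$$ for all $i,j\in[k]$ with $i\neq j$ and all $v_l\in S_i$.
   Context: Graphs are finite, simple and undirected with vertex set $V=\{v_1,\dots,v_n\}$; $A$ is the adjacency matrix and $D$ the diagonal degree matrix; $d_v(G)$ is the degree of $v$. For $X\subseteq V$ and $v\in X$, $d_v(X)$ is the number of neighbours of $v$ in $X$; for disjoint $X,Y\subseteq V$ and $v\in X$, $d_v(X,Y)$ is the number of neighbours of $v$ in $Y$.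
   Formalization: The eigenvalue q ranges over ℚ rather than the reals. -}

module Defs where

open import Data.Nat using (ℕ; zero; suc)
open import Data.Bool using (Bool; true; false; if_then_else_; _∧_)
open import Data.Fin using (Fin; zero; suc; _≟_)
open import Data.Integer using (+_)
open import Data.Rational using (ℚ; _/_; 0ℚ; 1ℚ; _+_; _*_; _-_)
open import Relation.Nullary.Decidable using (⌊_⌋)
open import Relation.Binary.PropositionalEquality using (_≡_)
open import Relation.Nullary using (¬_)
open import Data.Product using (_×_)

record Graph (n : ℕ) : Set where
  field
    adj   : Fin n → Fin n → Bool
    sym   : ∀ u v → adj u v ≡ adj v u
    irrefl : ∀ v → adj v v ≡ false
open Graph public

ℕ→ℚ : ℕ → ℚ
ℕ→ℚ m = + m / 1

count : ∀ {n} → (Fin n → Bool) → ℕ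
count {zero} p = 0
count {suc n} p = (if p zero then 1 else 0) Data.Nat.+ count (λ u → p (suc u))

sumℚ : ∀ {n} → (Fin n → ℚ) → ℚ
sumℚ {zero} f = 0ℚ
sumℚ {suc n} f = f zero + sumℚ (λ u → f (suc u))

deg : ∀ {n} → Graph n → Fin n → ℕ
deg G v = count (λ u → adj G v u)

-- number of neighbours of v inside part j of the partition (part : V → Fin k).
-- For v ∈ S_i this is d_v(S_i) when j = i and d_v(S_i,S_j) when j ≠ i.
degIn : ∀ {n k} → Graph n → (Fin n → Fin k) → Fin n → Fin k → ℕ
degIn G part v j = count (λ u → adj G v u ∧ ⌊ part u ≟ j ⌋)

signlessLaplacian : ∀ {n} → Graph n → Fin n → Fin n → ℚ
signlessLaplacian G v u =
  if ⌊ v ≟ u ⌋ then ℕ→ℚ (deg G v) else (if adj G v u then 1ℚ else 0ℚ)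

mulVec : ∀ {n} → (Fin n → Fin n → ℚ) → (Fin n → ℚ) → Fin n → ℚ
mulVec M x v = sumℚ (λ u → M v u * x u)

IsEigenpair : ∀ {n} → (Fin n → Fin n → ℚ) → ℚ → (Fin n → ℚ) → Set
IsEigenpair M q x = ¬ (∀ v → x v ≡ 0ℚ) × (∀ v → mulVec M x v ≡ q * x v)

sVec : ∀ {n k} → (Fin n → Fin k) → Fin k → Fin n → ℚ
sVec {k = k} part i v = if ⌊ part v ≟ i ⌋ then 1ℚ - ℕ→ℚ k else 1ℚ

{-# OPTIONS --safe #-}
-- Write d = d_v(G), a_j = d_v(S_j) and K = k. Since s⁽ⁱ⁾ = 𝟙 − K·χ(S_i), every row of Q = D + A gives
-- (Q s⁽ⁱ⁾)_v = d s⁽ⁱ⁾_v + d − K a_i. For v ∈ S_i and j ≠ i, subtracting the eigen-equation of s⁽ⁱ⁾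
-- at v from that of s⁽ʲ⁾ leaves K (d + a_i − a_j − q) = 0. Conversely, if the condition holds then
-- every a_j with j ≠ i equals c = d + a_i − q, so splitting d = Σ_j a_j over the parts gives
-- d + c = a_i + K c, which is exactly what both kinds of eigen-equations at v reduce to.
-- Finally s⁽ⁱ⁾ ≠ 0 because S_i is nonempty and K ≠ 1.
module Submission where

open import Defs hiding (sym)
open import Data.Nat using (ℕ; _≥_)
open import Data.Fin using (Fin)
open import Data.Rational using (ℚ; _+_; _-_)
open import Data.Product using (∃)
open import Relation.Binary.PropositionalEquality using (_≡_; _≢_)
open import Function.Bundles using (_⇔_)

open import Algebra.Bundles using (CommutativeRing)
import Algebra.Properties.Group as GroupProperties
open import Data.Bool using (Bool; true; false; if_then_else_; _∧_)
open import Data.Fin using (zero; suc; _≟_; punchIn)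
open import Data.Fin.Properties using (punchInᵢ≢i)
import Data.Integer as ℤ
import Data.Integer.Properties as ℤP
open import Data.Nat using (zero; suc)
open import Data.Nat.Properties using (m<n⇒n≢0; >⇒≢)
import Data.Nat as ℕ
open import Data.Nat.Coprimality using (1-coprimeTo) renaming (sym to coprime-sym)
open import Data.Product using (_,_; proj₂)
open import Data.Rational using (mkℚ; _*_; -_; 0ℚ; 1ℚ; 1/_; ↥_; NonZero; ≢-nonZero)
open import Data.Rational.Properties
  using ( normalize-coprime; /-cong; +-*-commutativeRing; +-0-group
        ; +-identityˡ; +-identityʳ; +-inverseʳ; *-zeroˡ; *-identityˡ; *-assoc; *-inverseˡ
        ; neg-distribˡ-* )
open import Data.Rational.Solver using (module +-*-Solver)
open import Function using (_∘_; mk⇔; Equivalence)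
open import Relation.Binary.PropositionalEquality using (refl; sym; trans; cong; cong₂; subst; module ≡-Reasoning)
open import Relation.Nullary.Decidable using (Dec; ⌊_⌋; yes; no)
open import Relation.Nullary.Negation using (¬_; contradiction)

open import Algebra.Properties.Semiring.Sum (CommutativeRing.semiring +-*-commutativeRing)
  using (sum; sum-syntax; sum-cong-≗; sum-replicate-zero; sum-remove; ∑-distrib-+; ∑-comm; *-distribˡ-sum)
open +-*-Solver using (solve; _:+_; _:-_; _:*_; :-_; _:=_; con)
open Equivalence using (to; from)

ℕ→ℚ≡mkℚ : ∀ m → ℕ→ℚ m ≡ mkℚ (ℤ.+ m) 0 (coprime-sym (1-coprimeTo m))
ℕ→ℚ≡mkℚ m = normalize-coprime (coprime-sym (1-coprimeTo m))

ℕ→ℚ-+ : ∀ m n → ℕ→ℚ (m ℕ.+ n) ≡ ℕ→ℚ m + ℕ→ℚ n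
ℕ→ℚ-+ m n = trans (/-cong numerators refl) (sym (cong₂ _+_ (ℕ→ℚ≡mkℚ m) (ℕ→ℚ≡mkℚ n)))
  where
  numerators : ℤ.+ (m ℕ.+ n) ≡ ℤ.+ m ℤ.* ℤ.+ 1 ℤ.+ ℤ.+ n ℤ.* ℤ.+ 1
  numerators = trans (ℤP.pos-+ m n) (sym (cong₂ ℤ._+_ (ℤP.*-identityʳ (ℤ.+ m)) (ℤP.*-identityʳ (ℤ.+ n))))

ℕ→ℚ-injective : ∀ {m n} → ℕ→ℚ m ≡ ℕ→ℚ n → m ≡ n
ℕ→ℚ-injective {m} {n} eq =
  ℤP.+-injective (cong ↥_ (trans (sym (ℕ→ℚ≡mkℚ m)) (trans eq (ℕ→ℚ≡mkℚ n))))

ℕ→ℚ-≢ : ∀ {m n} → m ≢ n → ℕ→ℚ m ≢ ℕ→ℚ n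
ℕ→ℚ-≢ m≢n = m≢n ∘ ℕ→ℚ-injective

*-cancelˡ-≢0 : ∀ {c x y} → c ≢ 0ℚ → c * x ≡ c * y → x ≡ y
*-cancelˡ-≢0 {c} {x} {y} c≢0 eq = begin
  x                  ≡⟨ sym (*-identityˡ x) ⟩
  1ℚ * x             ≡⟨ cong (_* x) (sym (*-inverseˡ c)) ⟩
  (1/ c * c) * x     ≡⟨ *-assoc (1/ c) c x ⟩
  1/ c * (c * x)     ≡⟨ cong (1/ c *_) eq ⟩
  1/ c * (c * y)     ≡⟨ sym (*-assoc (1/ c) c y) ⟩
  (1/ c * c) * y     ≡⟨ cong (_* y) (*-inverseˡ c) ⟩
  1ℚ * y             ≡⟨ *-identityˡ y ⟩
  y                  ∎
  where
  open ≡-Reasoning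
  instance
    c-nonZero : NonZero c
    c-nonZero = ≢-nonZero c≢0

x+y-z≡q⇒z≡x+y-q : ∀ x y {z q} → x + y - z ≡ q → z ≡ x + y - q
x+y-z≡q⇒z≡x+y-q x y {z} eq =
  trans (solve 3 (λ x y z → z := (x :+ y) :- ((x :+ y) :- z)) refl x y z) (cong (λ t → x + y - t) eq)

≡-via-difference : ∀ {e f x y} → e ≡ f + (x - y) → x ≡ y → e ≡ f
≡-via-difference {f = f} {y = y} e≡ refl = trans e≡ (trans (cong (f +_) (+-inverseʳ y)) (+-identityʳ f))

eigenEquations⇒ : ∀ d a b K q →
  d * 1ℚ + (d - K * b) ≡ q * 1ℚ → d * (1ℚ - K) + (d - K * a) ≡ q * (1ℚ - K) → K * (d + a - b) ≡ K * q
eigenEquations⇒ d a b K q outside inside = begin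
  K * (d + a - b)
    ≡⟨ solve 4 (λ d a b K → K :* (d :+ a :- b)
                         := (d :* con 1ℚ :+ (d :- K :* b)) :- (d :* (con 1ℚ :- K) :+ (d :- K :* a))) refl d a b K ⟩
  (d * 1ℚ + (d - K * b)) - (d * (1ℚ - K) + (d - K * a))
    ≡⟨ cong₂ _-_ outside inside ⟩
  q * 1ℚ - q * (1ℚ - K)
    ≡⟨ solve 2 (λ q K → q :* con 1ℚ :- q :* (con 1ℚ :- K) := K :* q) refl q K ⟩
  K * q
    ∎
  where open ≡-Reasoning

balance⇒eigenEquation-inside : ∀ d a K q →
  d + (d + a - q) ≡ a + K * (d + a - q) → d * (1ℚ - K) + (d - K * a) ≡ q * (1ℚ - K)
balance⇒eigenEquation-inside d a K q = ≡-via-difference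
  (solve 4 (λ d a K q → d :* (con 1ℚ :- K) :+ (d :- K :* a)
                     := q :* (con 1ℚ :- K) :+ ((d :+ (d :+ a :- q)) :- (a :+ K :* (d :+ a :- q)))) refl d a K q)

balance⇒eigenEquation-outside : ∀ d a K q →
  d + (d + a - q) ≡ a + K * (d + a - q) → d * 1ℚ + (d - K * (d + a - q)) ≡ q * 1ℚ
balance⇒eigenEquation-outside d a K q = ≡-via-difference
  (solve 4 (λ d a K q → d :* con 1ℚ :+ (d :- K :* (d :+ a :- q))
                     := q :* con 1ℚ :+ ((d :+ (d :+ a :- q)) :- (a :+ K :* (d :+ a :- q)))) refl d a K q)

indicator : Bool → ℚ
indicator b = if b then 1ℚ else 0ℚ

sumℚ≡sum : ∀ {n} (f : Fin n → ℚ) → sumℚ f ≡ sum f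
sumℚ≡sum {zero} f = refl
sumℚ≡sum {suc n} f = cong (f zero +_) (sumℚ≡sum (f ∘ suc))

count≡∑indicator : ∀ {n} (b : Fin n → Bool) → ℕ→ℚ (count b) ≡ ∑[ u < n ] indicator (b u)
count≡∑indicator {zero} b = refl
count≡∑indicator {suc n} b =
  trans (ℕ→ℚ-+ (if b zero then 1 else 0) (count (b ∘ suc)))
        (cong₂ _+_ (first (b zero)) (count≡∑indicator (b ∘ suc)))
  where
  first : ∀ c → ℕ→ℚ (if c then 1 else 0) ≡ indicator c
  first true = refl
  first false = refl

∑-const : ∀ n c → ∑[ _ < n ] c ≡ ℕ→ℚ n * c
∑-const zero c = sym (*-zeroˡ c)
∑-const (suc n) c = begin
  c + ∑[ _ < n ] c           ≡⟨ cong (c +_) (∑-const n c) ⟩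
  c + ℕ→ℚ n * c              ≡⟨ solve 2 (λ c m → c :+ m :* c := (con 1ℚ :+ m) :* c) refl c (ℕ→ℚ n) ⟩
  (1ℚ + ℕ→ℚ n) * c           ≡⟨ cong (_* c) (sym (ℕ→ℚ-+ 1 n)) ⟩
  ℕ→ℚ (suc n) * c            ∎
  where open ≡-Reasoning

⌊suc≟suc⌋ : ∀ {n} (v u : Fin n) → ⌊ suc v ≟ suc u ⌋ ≡ ⌊ v ≟ u ⌋
⌊suc≟suc⌋ v u with v ≟ u
... | yes _ = refl
... | no _ = refl

∑-δ : ∀ {n} (v : Fin n) x → ∑[ u < n ] (if ⌊ v ≟ u ⌋ then x else 0ℚ) ≡ x
∑-δ {suc n} zero x = trans (cong (x +_) (sum-replicate-zero n)) (+-identityʳ x)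
∑-δ {suc n} (suc v) x = trans (cong (0ℚ +_) (trans shift (∑-δ v x))) (+-identityˡ x)
  where
  shift : ∑[ u < n ] (if ⌊ suc v ≟ suc u ⌋ then x else 0ℚ) ≡ ∑[ u < n ] (if ⌊ v ≟ u ⌋ then x else 0ℚ)
  shift = sum-cong-≗ (λ u → cong (if_then x else 0ℚ) (⌊suc≟suc⌋ v u))

∑-except : ∀ {k} (f : Fin k → ℚ) a c → (∀ j → j ≢ a → f j ≡ c) → sum f + c ≡ f a + ℕ→ℚ k * c
∑-except {suc k} f a c f≡c = begin
  sum f + c                               ≡⟨ cong (_+ c) (sum-remove {i = a} f) ⟩
  f a + ∑[ j < k ] f (punchIn a j) + c     ≡⟨ cong (λ t → f a + t + c) (trans rest (∑-const k c)) ⟩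
  f a + ℕ→ℚ k * c + c
    ≡⟨ solve 3 (λ x m c → x :+ m :* c :+ c := x :+ (con 1ℚ :+ m) :* c) refl (f a) (ℕ→ℚ k) c ⟩
  f a + (1ℚ + ℕ→ℚ k) * c                  ≡⟨ cong (λ t → f a + t * c) (sym (ℕ→ℚ-+ 1 k)) ⟩
  f a + ℕ→ℚ (suc k) * c                   ∎
  where
  open ≡-Reasoning
  rest : ∑[ j < k ] f (punchIn a j) ≡ ∑[ _ < k ] c
  rest = sum-cong-≗ (λ j → f≡c (punchIn a j) (punchInᵢ≢i a j))

∑-indicator-∧-≟ : ∀ {k} b (p : Fin k) → ∑[ j < k ] indicator (b ∧ ⌊ p ≟ j ⌋) ≡ indicator b
∑-indicator-∧-≟ {k} false p = sum-replicate-zero k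
∑-indicator-∧-≟ true p = ∑-δ p 1ℚ

count≡∑count-∧-part : ∀ {n k} (b : Fin n → Bool) (part : Fin n → Fin k) →
  ℕ→ℚ (count b) ≡ ∑[ j < k ] ℕ→ℚ (count (λ u → b u ∧ ⌊ part u ≟ j ⌋))
count≡∑count-∧-part {n} {k} b part = begin
  ℕ→ℚ (count b)                            ≡⟨ count≡∑indicator b ⟩
  ∑[ u < n ] indicator (b u)               ≡⟨ sum-cong-≗ (λ u → sym (∑-indicator-∧-≟ (b u) (part u))) ⟩
  ∑[ u < n ] ∑[ j < k ] indicator (c u j)  ≡⟨ ∑-comm (λ u j → indicator (c u j)) ⟩
  ∑[ j < k ] ∑[ u < n ] indicator (c u j)  ≡⟨ sum-cong-≗ (λ j → sym (count≡∑indicator (λ u → c u j))) ⟩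
  ∑[ j < k ] ℕ→ℚ (count (λ u → c u j))     ∎
  where
  open ≡-Reasoning
  c : Fin n → Fin k → Bool
  c u j = b u ∧ ⌊ part u ≟ j ⌋

deg≡∑degIn : ∀ {n k} (G : Graph n) (part : Fin n → Fin k) v →
  ℕ→ℚ (deg G v) ≡ ∑[ j < k ] ℕ→ℚ (degIn G part v j)
deg≡∑degIn G part v = count≡∑count-∧-part (adj G v) part

signlessLaplacian-*-split : ∀ {n} (G : Graph n) (x : Fin n → ℚ) v u →
  signlessLaplacian G v u * x u
    ≡ (if ⌊ v ≟ u ⌋ then ℕ→ℚ (deg G v) * x v else 0ℚ) + indicator (adj G v u) * x u
signlessLaplacian-*-split G x v u with v ≟ u
... | yes refl rewrite irrefl G v = sym (trans (cong (dv +_) (*-zeroˡ (x v))) (+-identityʳ dv))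
  where
  dv : ℚ
  dv = ℕ→ℚ (deg G v) * x v
... | no _ = sym (+-identityˡ _)

mulVec-signlessLaplacian : ∀ {n} (G : Graph n) (x : Fin n → ℚ) v →
  mulVec (signlessLaplacian G) x v ≡ ℕ→ℚ (deg G v) * x v + ∑[ u < n ] (indicator (adj G v u) * x u)
mulVec-signlessLaplacian {n} G x v = begin
  sumℚ (λ u → signlessLaplacian G v u * x u)  ≡⟨ sumℚ≡sum (λ u → signlessLaplacian G v u * x u) ⟩
  ∑[ u < n ] (signlessLaplacian G v u * x u)   ≡⟨ sum-cong-≗ (signlessLaplacian-*-split G x v) ⟩
  ∑[ u < n ] (δ u + a u)                       ≡⟨ ∑-distrib-+ δ a ⟩
  sum δ + sum a                                ≡⟨ cong (_+ sum a) (∑-δ v (ℕ→ℚ (deg G v) * x v)) ⟩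
  ℕ→ℚ (deg G v) * x v + sum a                  ∎
  where
  open ≡-Reasoning
  δ : Fin n → ℚ
  δ u = if ⌊ v ≟ u ⌋ then ℕ→ℚ (deg G v) * x v else 0ℚ
  a : Fin n → ℚ
  a u = indicator (adj G v u) * x u

sVec-inside : ∀ {n k} (part : Fin n → Fin k) {i v} → part v ≡ i → sVec part i v ≡ 1ℚ - ℕ→ℚ k
sVec-inside part {i} {v} v∈Sᵢ with part v ≟ i
... | yes _ = refl
... | no v∉Sᵢ = contradiction v∈Sᵢ v∉Sᵢ

sVec-outside : ∀ {n k} (part : Fin n → Fin k) {i v} → part v ≢ i → sVec part i v ≡ 1ℚ
sVec-outside part {i} {v} v∉Sᵢ with part v ≟ i
... | yes v∈Sᵢ = contradiction v∈Sᵢ v∉Sᵢ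
... | no _ = refl

indicator-*-sVec-entry : ∀ b c K →
  indicator b * (if c then 1ℚ - K else 1ℚ) ≡ indicator b + - K * indicator (b ∧ c)
indicator-*-sVec-entry false c K =
  solve 2 (λ s K → con 0ℚ :* s := con 0ℚ :+ :- K :* con 0ℚ) refl (if c then 1ℚ - K else 1ℚ) K
indicator-*-sVec-entry true true K = solve 1 (λ K → con 1ℚ :* (con 1ℚ :- K) := con 1ℚ :+ :- K :* con 1ℚ) refl K
indicator-*-sVec-entry true false K = solve 1 (λ K → con 1ℚ :* con 1ℚ := con 1ℚ :+ :- K :* con 0ℚ) refl K

∑-adj-*-sVec : ∀ {n k} (G : Graph n) (part : Fin n → Fin k) i v →
  ∑[ u < n ] (indicator (adj G v u) * sVec part i u) ≡ ℕ→ℚ (deg G v) - ℕ→ℚ k * ℕ→ℚ (degIn G part v i)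
∑-adj-*-sVec {n} {k} G part i v = begin
  ∑[ u < n ] (indicator (adj G v u) * sVec part i u)
    ≡⟨ sum-cong-≗ (λ u → indicator-*-sVec-entry (adj G v u) ⌊ part u ≟ i ⌋ K) ⟩
  ∑[ u < n ] (a u + - K * b u)                   ≡⟨ ∑-distrib-+ a (λ u → - K * b u) ⟩
  sum a + ∑[ u < n ] (- K * b u)                 ≡⟨ cong (sum a +_) (sym (*-distribˡ-sum (- K) b)) ⟩
  sum a + - K * sum b
    ≡⟨ cong₂ (λ x y → x + - K * y) (sym (count≡∑indicator (adj G v))) (sym (count≡∑indicator inSᵢ)) ⟩
  ℕ→ℚ (deg G v) + - K * ℕ→ℚ (degIn G part v i)
    ≡⟨ cong (ℕ→ℚ (deg G v) +_) (sym (neg-distribˡ-* K _)) ⟩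
  ℕ→ℚ (deg G v) - K * ℕ→ℚ (degIn G part v i)    ∎
  where
  open ≡-Reasoning
  K : ℚ
  K = ℕ→ℚ k
  inSᵢ : Fin n → Bool
  inSᵢ u = adj G v u ∧ ⌊ part u ≟ i ⌋
  a b : Fin n → ℚ
  a u = indicator (adj G v u)
  b u = indicator (inSᵢ u)

mulVec-signlessLaplacian-sVec : ∀ {n k} (G : Graph n) (part : Fin n → Fin k) i v →
  mulVec (signlessLaplacian G) (sVec part i) v
    ≡ ℕ→ℚ (deg G v) * sVec part i v + (ℕ→ℚ (deg G v) - ℕ→ℚ k * ℕ→ℚ (degIn G part v i))
mulVec-signlessLaplacian-sVec G part i v =
  trans (mulVec-signlessLaplacian G (sVec part i) v)
        (cong (ℕ→ℚ (deg G v) * sVec part i v +_) (∑-adj-*-sVec G part i v))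

module _ {n k} (G : Graph n) (part : Fin n → Fin k) (q : ℚ) where

  private
    K : ℚ
    K = ℕ→ℚ k
    D : Fin n → ℚ
    D v = ℕ→ℚ (deg G v)
    A : Fin n → Fin k → ℚ
    A v j = ℕ→ℚ (degIn G part v j)

  EigenEquationAt : Fin k → Fin n → Set
  EigenEquationAt i v = mulVec (signlessLaplacian G) (sVec part i) v ≡ q * sVec part i v

  PartDegreeCondition : Set
  PartDegreeCondition = ∀ i j → i ≢ j → ∀ v → part v ≡ i → D v + A v i - A v j ≡ q

  eigenEquationAt⇔ : ∀ {i v s} → sVec part i v ≡ s →
    EigenEquationAt i v ⇔ (D v * s + (D v - K * A v i) ≡ q * s)
  eigenEquationAt⇔ {i} {v} refl = mk⇔ (trans (sym Qs)) (trans Qs)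
    where
    Qs : mulVec (signlessLaplacian G) (sVec part i) v ≡ D v * sVec part i v + (D v - K * A v i)
    Qs = mulVec-signlessLaplacian-sVec G part i v

  eigenEquations⇒partDegreeCondition : k ≥ 2 → (∀ i v → EigenEquationAt i v) → PartDegreeCondition
  eigenEquations⇒partDegreeCondition k≥2 E i j i≢j v v∈Sᵢ =
    *-cancelˡ-≢0 (ℕ→ℚ-≢ (m<n⇒n≢0 k≥2)) (eigenEquations⇒ (D v) (A v i) (A v j) K q outside inside)
    where
    outside : D v * 1ℚ + (D v - K * A v j) ≡ q * 1ℚ
    outside = to (eigenEquationAt⇔ (sVec-outside part (i≢j ∘ trans (sym v∈Sᵢ)))) (E j v)
    inside : D v * (1ℚ - K) + (D v - K * A v i) ≡ q * (1ℚ - K)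
    inside = to (eigenEquationAt⇔ (sVec-inside part v∈Sᵢ)) (E i v)

  otherPart-share : PartDegreeCondition → ∀ v j → part v ≢ j → A v j ≡ D v + A v (part v) - q
  otherPart-share H v j w≢j = x+y-z≡q⇒z≡x+y-q (D v) (A v (part v)) (H (part v) j w≢j v refl)

  degree-balance : PartDegreeCondition → ∀ v →
    D v + (D v + A v (part v) - q) ≡ A v (part v) + K * (D v + A v (part v) - q)
  degree-balance H v = trans (cong (_+ c) (deg≡∑degIn G part v))
    (∑-except (A v) (part v) c (λ j j≢w → otherPart-share H v j (j≢w ∘ sym)))
    where
    c : ℚ
    c = D v + A v (part v) - q

  partDegreeCondition⇒eigenEquation : PartDegreeCondition → ∀ i v → EigenEquationAt i v
  partDegreeCondition⇒eigenEquation H i v = byPart (part v ≟ i)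
    where
    byPart : ∀ {i} → Dec (part v ≡ i) → EigenEquationAt i v
    byPart (yes refl) = from (eigenEquationAt⇔ (sVec-inside part refl))
      (balance⇒eigenEquation-inside (D v) (A v (part v)) K q (degree-balance H v))
    byPart {i} (no w≢i) = from (eigenEquationAt⇔ (sVec-outside part w≢i))
      (subst (λ b → D v * 1ℚ + (D v - K * b) ≡ q * 1ℚ) (sym (otherPart-share H v i w≢i))
        (balance⇒eigenEquation-outside (D v) (A v (part v)) K q (degree-balance H v)))

  sVec-nonzero : k ≥ 2 → ∀ {i} → (∃ λ v → part v ≡ i) → ¬ (∀ v → sVec part i v ≡ 0ℚ)
  sVec-nonzero k≥2 (v , v∈Sᵢ) s≡0 =
    ℕ→ℚ-≢ (>⇒≢ k≥2) (sym (x∙y⁻¹≈ε⇒x≈y 1ℚ K (trans (sym (sVec-inside part v∈Sᵢ)) (s≡0 v))))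
    where open GroupProperties +-0-group using (x∙y⁻¹≈ε⇒x≈y)

corollary4p3 : ∀ {n k : ℕ} (G : Graph n) (part : Fin n → Fin k) → k ≥ 2
    → (∀ i → ∃ λ v → part v ≡ i)
    → (q : ℚ)
    → ((∀ i → IsEigenpair (signlessLaplacian G) q (sVec part i))
       ⇔ (∀ i j → i ≢ j → ∀ v → part v ≡ i
            → ℕ→ℚ (deg G v) + ℕ→ℚ (degIn G part v i) - ℕ→ℚ (degIn G part v j) ≡ q))
corollary4p3 G part k≥2 nonempty q = mk⇔
  (λ E → eigenEquations⇒partDegreeCondition G part q k≥2 (λ i → proj₂ (E i)))
  (λ H i → sVec-nonzero G part q k≥2 (nonempty i) , partDegreeCondition⇒eigenEquation G part q H i)
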